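{- Let $\Sigma,\Sigma'$ be sets of $\mathcal{L}^+$-sentences, $\Gamma$ a finite set of $\mathcal{L}^+$-sentences and $\phi$ an $\mathcal{L}^+$-sentence. If there exists a proof $\Pi$ in $\mathcal{N}\mathsf{BQL}_{\mathsf{CD}}(\Sigma)$ of $\phi$ from $\Sigma'\cup\Gamma$ such that every open assumption which occurs unsafely in $\Pi$ is contained in $\Sigma'$, then $\Sigma'\vdash\bigwedge\Gamma\rightarrow\phi$ (where $\bigwedge\emptyset=\top$).
   Context: Let $\mathcal{L}$ be a first-order language whose formulas are built from atomic formulas, $\top$ and $\bot$ using exactly $\wedge,\vee,\rightarrow,\forall,\exists$, and let $\mathcal{L}^+=\mathcal{L}\cup\{a_i\}_{i\in\omega}$ with the $a_i$ fresh constant symbols. $\bigwedge\Gamma$ denotes the conjunction of the members of the finite set $\Gamma$. The natural deduction system $\mathcal{N}\mathsf{BQL}_{\mathsf{CD}}$ consists of trees of (possibly discharged) $\mathcal{L}^+$-sentences built with the following rules, where all displayed formulas are sentences (so e.g. in CD, $v$ is not free in $\phi$), $t$ ranges over closed $\mathcal{L}^+$-terms, and $\phi(t)$ denotes substitution for the free variable $v$: ($\top$-Int) $\top$ may be placed at a leaf as an already-discharged assumption; ($\bot$-Elim) from $\bot$ infer $\phi$; ($\wedge$-Int) from $\phi,\psi$ infer $\phi\wedge\psi$; ($\wedge$-Elim) from $\phi\wedge\psi$ infer $\phi$, or infer $\psi$; ($\vee$-Int) from $\phi$ or from $\psi$ infer $\phi\vee\psi$; ($\vee$-Elim) from $\phi\vee\psi$,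 a derivation of $\chi$ from assumption $\phi$ and a derivation of $\chi$ from assumption $\psi$, infer $\chi$, discharging those assumptions; ($\rightarrow$-Int) from a derivation of $\psi$ from assumption $\phi$ infer $\phi\rightarrow\psi$, discharging $\phi$; (Internal Transitivity) from $\phi\rightarrow\psi$ and $\psi\rightarrow\chi$ infer $\phi\rightarrow\chi$; (Internal $\wedge$-Int) from $\phi\rightarrow\psi$ and $\phi\rightarrow\chi$ infer $\phi\rightarrow\psi\wedge\chi$; (Internal $\vee$-Elim) from $\phi\rightarrow\chi$ and $\psi\rightarrow\chi$ infer $\phi\vee\psi\rightarrow\chi$; (Internal $\forall$-Int) from $\forall v(\phi\rightarrow\psi)$ infer $\phi\rightarrow\forall v\psi$; (Internal $\exists$-Elim) from $\forall v(\phi\rightarrow\psi)$ infer $\exists v\phi\rightarrow\psi$; ($\forall$-Int) from $\phi(a_i)$ infer $\forall v\phi$, provided $a_i$ occurs neither in $\phi$ nor in any open assumption of the derivation of $\phi(a_i)$; ($\forall$-Elim) from $\forall v\phi$ infer $\phi(t)$; (CD) from $\forall v(\phi\vee\psi)$ infer $\phi\vee\forall v\psi$; ($\exists$-Int) from $\phi(t)$ infer $\exists v\phi$; ($\exists$-Elim) from $\exists v\phi$ and a derivation of $\psi$ from assumption $\phi(a_i)$ infer $\psi$, discharging $\phi(a_i)$, provided $a_i$ occurs neither in $\phi$, nor in $\psi$, nor in any open assumption other than $\phi(a_i)$ of that derivation. There is no modus ponens rule. $\Gamma\vdash\phi$ means there is such a tree with root $\phi$ all of whose open assumptions lie in $\Gamma$.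 For a set $\Sigma$ of $\mathcal{L}^+$-sentences, $\mathcal{N}\mathsf{BQL}_{\mathsf{CD}}(\Sigma)$ is obtained from $\mathcal{N}\mathsf{BQL}_{\mathsf{CD}}$ by adding the rule: from $\phi$ and $\phi\rightarrow\psi$ infer $\psi$, where the premise $\phi\rightarrow\psi$ must be the conclusion of a derivation in $\mathcal{N}\mathsf{BQL}_{\mathsf{CD}}$ from assumptions in $\Sigma$. An occurrence of an open assumption lying in such a derivation of the premise $\phi\rightarrow\psi$ of an application of this new rule is called unsafe. The system imposes the restrictions: (i) no unsafe occurrence of an assumption can be discharged; (ii) in $\exists$-Elim, no occurrence of the assumption $\phi(a_i)$ in the derivation of the minor premise may be unsafe. A proof of $\phi$ from a set $\Delta$ in $\mathcal{N}\mathsf{BQL}_{\mathsf{CD}}(\Sigma)$ is such a tree with root $\phi$ all of whose open assumptions lie in $\Delta$. -}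

module Defs where

open import Level using (0ℓ)
open import Data.Nat using (ℕ; zero; suc)
open import Data.Fin using (Fin; zero; suc)
open import Data.Vec using (Vec; []; _∷_)
open import Data.List using (List; []; _∷_)
open import Data.List.Membership.Propositional using (_∈_)
open import Data.Empty using (⊥)
open import Data.Sum using (_⊎_)
open import Relation.Binary.PropositionalEquality using (_≡_)
open import Relation.Nullary using (¬_)
open import Relation.Unary using (Pred; _⊆_; _∪_; _∩_; ｛_｝)

record Signature : Set₁ where
  field
    Func      : Set
    funcArity : Func → ℕ
    Rel       : Set
    relArity  : Rel → ℕ

module Syntax (L : Signature) where
  open Signature L

  -- 𝓛⁺-terms with n bound variables in scope (de Bruijn indices);
  -- par i is the fresh constant a_i.
  data Term (n : ℕ) : Set where
    var : Fin n → Term n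
    par : ℕ → Term n
    app : (f : Func) → Vec (Term n) (funcArity f) → Term n

  data Formula (n : ℕ) : Set where
    atom      : (R : Rel) → Vec (Term n) (relArity R) → Formula n
    ⊤' ⊥'     : Formula n
    _∧'_ _∨'_ _⇒_ : Formula n → Formula n → Formula n
    ∀' ∃'     : Formula (suc n) → Formula n

  infixr 6 _∧'_
  infixr 5 _∨'_
  infixr 4 _⇒_

  Sentence : Set
  Sentence = Formula 0

  ClosedTerm : Set
  ClosedTerm = Term 0

  liftR : ∀ {n m} → (Fin n → Fin m) → Fin (suc n) → Fin (suc m)
  liftR ρ zero    = zero
  liftR ρ (suc x) = suc (ρ x)

  mutual
    renT : ∀ {n m} → (Fin n → Fin m) → Term n → Term m
    renT ρ (var x)    = var (ρ x)
    renT ρ (par i)    = par i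
    renT ρ (app f ts) = app f (renTs ρ ts)

    renTs : ∀ {n m k} → (Fin n → Fin m) → Vec (Term n) k → Vec (Term m) k
    renTs ρ []       = []
    renTs ρ (t ∷ ts) = renT ρ t ∷ renTs ρ ts

  renF : ∀ {n m} → (Fin n → Fin m) → Formula n → Formula m
  renF ρ (atom R ts) = atom R (renTs ρ ts)
  renF ρ ⊤'          = ⊤'
  renF ρ ⊥'          = ⊥'
  renF ρ (φ ∧' ψ)    = renF ρ φ ∧' renF ρ ψ
  renF ρ (φ ∨' ψ)    = renF ρ φ ∨' renF ρ ψ
  renF ρ (φ ⇒ ψ)     = renF ρ φ ⇒ renF ρ ψ
  renF ρ (∀' φ)      = ∀' (renF (liftR ρ) φ)
  renF ρ (∃' φ)      = ∃' (renF (liftR ρ) φ)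

  -- weakening: regard a formula as one in a scope with one more variable
  -- (used to express "v is not free in φ")
  wk : ∀ {n} → Formula n → Formula (suc n)
  wk = renF suc

  liftS : ∀ {n m} → (Fin n → Term m) → Fin (suc n) → Term (suc m)
  liftS σ zero    = var zero
  liftS σ (suc x) = renT suc (σ x)

  mutual
    subT : ∀ {n m} → (Fin n → Term m) → Term n → Term m
    subT σ (var x)    = σ x
    subT σ (par i)    = par i
    subT σ (app f ts) = app f (subTs σ ts)

    subTs : ∀ {n m k} → (Fin n → Term m) → Vec (Term n) k → Vec (Term m) k
    subTs σ []       = []
    subTs σ (t ∷ ts) = subT σ t ∷ subTs σ ts

  subF : ∀ {n m} → (Fin n → Term m) → Formula n → Formula m
  subF σ (atom R ts) = atom R (subTs σ ts)
  subF σ ⊤'          = ⊤'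
  subF σ ⊥'          = ⊥'
  subF σ (φ ∧' ψ)    = subF σ φ ∧' subF σ ψ
  subF σ (φ ∨' ψ)    = subF σ φ ∨' subF σ ψ
  subF σ (φ ⇒ ψ)     = subF σ φ ⇒ subF σ ψ
  subF σ (∀' φ)      = ∀' (subF (liftS σ) φ)
  subF σ (∃' φ)      = ∃' (subF (liftS σ) φ)

  single : ClosedTerm → Fin 1 → ClosedTerm
  single t zero = t

  _[_] : Formula 1 → ClosedTerm → Sentence
  φ [ t ] = subF (single t) φ

  mutual
    occT : ∀ {n} → ℕ → Term n → Set
    occT i (var x)    = ⊥
    occT i (par j)    = i ≡ j
    occT i (app f ts) = occTs i ts

    occTs : ∀ {n k} → ℕ → Vec (Term n) k → Set
    occTs i []       = ⊥
    occTs i (t ∷ ts) = occT i t ⊎ occTs i ts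

  occF : ∀ {n} → ℕ → Formula n → Set
  occF i (atom R ts) = occTs i ts
  occF i ⊤'          = ⊥
  occF i ⊥'          = ⊥
  occF i (φ ∧' ψ)    = occF i φ ⊎ occF i ψ
  occF i (φ ∨' ψ)    = occF i φ ⊎ occF i ψ
  occF i (φ ⇒ ψ)     = occF i φ ⊎ occF i ψ
  occF i (∀' φ)      = occF i φ
  occF i (∃' φ)      = occF i φ

  Avoids : ℕ → Pred Sentence 0ℓ → Set
  Avoids i Δ = ∀ {χ} → Δ χ → ¬ occF i χ

  -- ⋀Γ for a finite set Γ given as a list; ⋀∅ = ⊤, ⋀{φ} = φ
  ⋀ : List Sentence → Sentence
  ⋀ []           = ⊤'
  ⋀ (φ ∷ [])     = φ
  ⋀ (φ ∷ ψ ∷ Γ)  = φ ∧' ⋀ (ψ ∷ Γ)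

  ListSet : List Sentence → Pred Sentence 0ℓ
  ListSet Γ χ = χ ∈ Γ

  -- BQL Δ φ : a derivation tree with root φ all of whose open
  -- assumptions lie in Δ.  Discharging φ = adding φ to the bound on the
  -- open assumptions of the subderivation.  Eigenvariable conditions are
  -- stated via a set Δ' ⊆ Δ bounding the open assumptions of the
  -- relevant subderivation.

  data BQL : Pred Sentence 0ℓ → Sentence → Set₁ where
    hyp    : ∀ {Δ φ} → Δ φ → BQL Δ φ
    ⊤I     : ∀ {Δ} → BQL Δ ⊤'
    ⊥E     : ∀ {Δ φ} → BQL Δ ⊥' → BQL Δ φ
    ∧I     : ∀ {Δ φ ψ} → BQL Δ φ → BQL Δ ψ → BQL Δ (φ ∧' ψ)
    ∧E₁    : ∀ {Δ φ ψ} → BQL Δ (φ ∧' ψ) → BQL Δ φ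
    ∧E₂    : ∀ {Δ φ ψ} → BQL Δ (φ ∧' ψ) → BQL Δ ψ
    ∨I₁    : ∀ {Δ φ ψ} → BQL Δ φ → BQL Δ (φ ∨' ψ)
    ∨I₂    : ∀ {Δ φ ψ} → BQL Δ ψ → BQL Δ (φ ∨' ψ)
    ∨E     : ∀ {Δ φ ψ χ} → BQL Δ (φ ∨' ψ) →
             BQL (Δ ∪ ｛ φ ｝) χ → BQL (Δ ∪ ｛ ψ ｝) χ → BQL Δ χ
    ⇒I     : ∀ {Δ φ ψ} → BQL (Δ ∪ ｛ φ ｝) ψ → BQL Δ (φ ⇒ ψ)
    iTrans : ∀ {Δ φ ψ χ} → BQL Δ (φ ⇒ ψ) → BQL Δ (ψ ⇒ χ) → BQL Δ (φ ⇒ χ)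
    i∧I    : ∀ {Δ φ ψ χ} → BQL Δ (φ ⇒ ψ) → BQL Δ (φ ⇒ χ) → BQL Δ (φ ⇒ ψ ∧' χ)
    i∨E    : ∀ {Δ φ ψ χ} → BQL Δ (φ ⇒ χ) → BQL Δ (ψ ⇒ χ) → BQL Δ (φ ∨' ψ ⇒ χ)
    i∀I    : ∀ {Δ} {φ : Sentence} {ψ : Formula 1} →
             BQL Δ (∀' (wk φ ⇒ ψ)) → BQL Δ (φ ⇒ ∀' ψ)
    i∃E    : ∀ {Δ} {φ : Formula 1} {ψ : Sentence} →
             BQL Δ (∀' (φ ⇒ wk ψ)) → BQL Δ (∃' φ ⇒ ψ)
    ∀I     : ∀ {Δ} {φ : Formula 1} (i : ℕ) (Δ' : Pred Sentence 0ℓ) →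
             Δ' ⊆ Δ → Avoids i Δ' → ¬ occF i φ →
             BQL Δ' (φ [ par i ]) → BQL Δ (∀' φ)
    ∀E     : ∀ {Δ} {φ : Formula 1} (t : ClosedTerm) →
             BQL Δ (∀' φ) → BQL Δ (φ [ t ])
    CD     : ∀ {Δ} {φ : Sentence} {ψ : Formula 1} →
             BQL Δ (∀' (wk φ ∨' ψ)) → BQL Δ (φ ∨' ∀' ψ)
    ∃I     : ∀ {Δ} {φ : Formula 1} (t : ClosedTerm) →
             BQL Δ (φ [ t ]) → BQL Δ (∃' φ)
    ∃E     : ∀ {Δ} {φ : Formula 1} {ψ : Sentence} (i : ℕ) (Δ' : Pred Sentence 0ℓ) →
             BQL Δ (∃' φ) →
             Δ' ⊆ Δ → Avoids i Δ' → ¬ occF i φ → ¬ occF i ψ →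
             BQL (Δ' ∪ ｛ φ [ par i ] ｝) ψ → BQL Δ ψ

  -- BQLΣ Σ S U φ : a proof tree with root φ whose safe open
  -- assumption occurrences lie in S and whose unsafe open assumption
  -- occurrences lie in U.  Discharge only adds to the safe bound, so
  -- unsafe occurrences can never be discharged (restriction (i)).
  -- The new rule `mp' takes a 𝒩BQL_CD-derivation of φ ⇒ ψ from
  -- assumptions in Σ; its open assumptions are unsafe, hence in U.

  data BQLΣ (Σ : Pred Sentence 0ℓ) :
            Pred Sentence 0ℓ → Pred Sentence 0ℓ → Sentence → Set₁ where
    hyp    : ∀ {S U φ} → S φ → BQLΣ Σ S U φ
    ⊤I     : ∀ {S U} → BQLΣ Σ S U ⊤'
    ⊥E     : ∀ {S U φ} → BQLΣ Σ S U ⊥' → BQLΣ Σ S U φ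
    ∧I     : ∀ {S U φ ψ} → BQLΣ Σ S U φ → BQLΣ Σ S U ψ → BQLΣ Σ S U (φ ∧' ψ)
    ∧E₁    : ∀ {S U φ ψ} → BQLΣ Σ S U (φ ∧' ψ) → BQLΣ Σ S U φ
    ∧E₂    : ∀ {S U φ ψ} → BQLΣ Σ S U (φ ∧' ψ) → BQLΣ Σ S U ψ
    ∨I₁    : ∀ {S U φ ψ} → BQLΣ Σ S U φ → BQLΣ Σ S U (φ ∨' ψ)
    ∨I₂    : ∀ {S U φ ψ} → BQLΣ Σ S U ψ → BQLΣ Σ S U (φ ∨' ψ)
    ∨E     : ∀ {S U φ ψ χ} → BQLΣ Σ S U (φ ∨' ψ) →
             BQLΣ Σ (S ∪ ｛ φ ｝) U χ → BQLΣ Σ (S ∪ ｛ ψ ｝) U χ → BQLΣ Σ S U χ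
    ⇒I     : ∀ {S U φ ψ} → BQLΣ Σ (S ∪ ｛ φ ｝) U ψ → BQLΣ Σ S U (φ ⇒ ψ)
    iTrans : ∀ {S U φ ψ χ} → BQLΣ Σ S U (φ ⇒ ψ) → BQLΣ Σ S U (ψ ⇒ χ) →
             BQLΣ Σ S U (φ ⇒ χ)
    i∧I    : ∀ {S U φ ψ χ} → BQLΣ Σ S U (φ ⇒ ψ) → BQLΣ Σ S U (φ ⇒ χ) →
             BQLΣ Σ S U (φ ⇒ ψ ∧' χ)
    i∨E    : ∀ {S U φ ψ χ} → BQLΣ Σ S U (φ ⇒ χ) → BQLΣ Σ S U (ψ ⇒ χ) →
             BQLΣ Σ S U (φ ∨' ψ ⇒ χ)
    i∀I    : ∀ {S U} {φ : Sentence} {ψ : Formula 1} →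
             BQLΣ Σ S U (∀' (wk φ ⇒ ψ)) → BQLΣ Σ S U (φ ⇒ ∀' ψ)
    i∃E    : ∀ {S U} {φ : Formula 1} {ψ : Sentence} →
             BQLΣ Σ S U (∀' (φ ⇒ wk ψ)) → BQLΣ Σ S U (∃' φ ⇒ ψ)
    ∀I     : ∀ {S U} {φ : Formula 1} (i : ℕ) (S' U' : Pred Sentence 0ℓ) →
             S' ⊆ S → U' ⊆ U → Avoids i S' → Avoids i U' → ¬ occF i φ →
             BQLΣ Σ S' U' (φ [ par i ]) → BQLΣ Σ S U (∀' φ)
    ∀E     : ∀ {S U} {φ : Formula 1} (t : ClosedTerm) →
             BQLΣ Σ S U (∀' φ) → BQLΣ Σ S U (φ [ t ])
    CD     : ∀ {S U} {φ : Sentence} {ψ : Formula 1} →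
             BQLΣ Σ S U (∀' (wk φ ∨' ψ)) → BQLΣ Σ S U (φ ∨' ∀' ψ)
    ∃I     : ∀ {S U} {φ : Formula 1} (t : ClosedTerm) →
             BQLΣ Σ S U (φ [ t ]) → BQLΣ Σ S U (∃' φ)
    ∃E     : ∀ {S U} {φ : Formula 1} {ψ : Sentence} (i : ℕ) (S' U' : Pred Sentence 0ℓ) →
             BQLΣ Σ S U (∃' φ) →
             S' ⊆ S → U' ⊆ U → Avoids i S' → Avoids i U' →
             ¬ U' (φ [ par i ]) →
             ¬ occF i φ → ¬ occF i ψ →
             BQLΣ Σ (S' ∪ ｛ φ [ par i ] ｝) U' ψ → BQLΣ Σ S U ψ
    mp     : ∀ {S U φ ψ} → BQLΣ Σ S U φ → BQL (Σ ∩ U) (φ ⇒ ψ) → BQLΣ Σ S U ψ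

module Submission where

-- We prove the general statement `deduction`: if every safe
-- open assumption lies in Δ ∪ Γ and every unsafe one in Δ, then
-- Δ ⊢ ⋀⊤Γ → φ, where ⋀⊤Γ is the ⊤-terminated conjunction of the list Γ.
-- The proof is by induction on the 𝒩BQL_CD(Σ)-tree, replacing each rule
-- by its "internal" version under the antecedent ⋀⊤Γ (built from the
-- internal rules iTrans, i∧I, i∨E, i∀I, i∃E of 𝒩BQL_CD).  Discharging an
-- assumption χ moves it into the antecedent (⋀⊤(χ ∷ Γ) = χ ∧ ⋀⊤Γ); the
-- eigenvariable rules ∀I/∃E are handled by first dropping from Γ every
-- member in which the eigenvariable occurs; an application of the new
-- rule becomes an internal transitivity, because the derivation of its
-- premise φ ⇒ ψ has only unsafe, hence Δ-, assumptions.

open import Defs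
open import Level using (0ℓ)
open import Data.Nat using (ℕ)
import Data.Nat as ℕ
open import Data.Fin using (Fin; zero; suc)
open import Data.Vec using (Vec; []; _∷_)
open import Data.List using (List; []; _∷_; filter)
open import Data.List.Membership.Propositional using (_∈_)
open import Data.List.Membership.Propositional.Properties using (∈-filter⁺; ∈-filter⁻)
open import Data.List.Relation.Unary.Any using (here; there)
open import Data.Sum using (inj₁; inj₂; [_,_])
import Data.Sum as ⊎
open import Data.Product using (_,_; proj₁; proj₂)
open import Function using (id; _∘_)
open import Relation.Binary.PropositionalEquality using (_≡_; refl; sym; cong; cong₂; subst)
open import Relation.Nullary using (¬_; Dec; no; ¬?)
open import Relation.Nullary.Decidable using (_⊎-dec_)
open import Relation.Unary using (Pred; _∪_; _∩_; _⊆_; ｛_｝)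

module Deduction (L : Signature) where
  open Syntax L

  BQL-mono : ∀ {Δ Δ′ φ} → Δ ⊆ Δ′ → BQL Δ φ → BQL Δ′ φ
  BQL-mono f (hyp x)        = hyp (f x)
  BQL-mono f ⊤I             = ⊤I
  BQL-mono f (⊥E d)         = ⊥E (BQL-mono f d)
  BQL-mono f (∧I d e)       = ∧I (BQL-mono f d) (BQL-mono f e)
  BQL-mono f (∧E₁ d)        = ∧E₁ (BQL-mono f d)
  BQL-mono f (∧E₂ d)        = ∧E₂ (BQL-mono f d)
  BQL-mono f (∨I₁ d)        = ∨I₁ (BQL-mono f d)
  BQL-mono f (∨I₂ d)        = ∨I₂ (BQL-mono f d)
  BQL-mono f (∨E d e g)     = ∨E (BQL-mono f d) (BQL-mono (⊎.map₁ f) e)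
                                                (BQL-mono (⊎.map₁ f) g)
  BQL-mono f (⇒I d)         = ⇒I (BQL-mono (⊎.map₁ f) d)
  BQL-mono f (iTrans d e)   = iTrans (BQL-mono f d) (BQL-mono f e)
  BQL-mono f (i∧I d e)      = i∧I (BQL-mono f d) (BQL-mono f e)
  BQL-mono f (i∨E d e)      = i∨E (BQL-mono f d) (BQL-mono f e)
  BQL-mono f (i∀I d)        = i∀I (BQL-mono f d)
  BQL-mono f (i∃E d)        = i∃E (BQL-mono f d)
  BQL-mono f (∀I i Δ′ s a n d)           = ∀I i Δ′ (f ∘ s) a n d
  BQL-mono f (∀E t d)       = ∀E t (BQL-mono f d)
  BQL-mono f (CD d)         = CD (BQL-mono f d)
  BQL-mono f (∃I t d)       = ∃I t (BQL-mono f d)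
  BQL-mono f (∃E i Δ′ d s a n₁ n₂ e) = ∃E i Δ′ (BQL-mono f d) (f ∘ s) a n₁ n₂ e

  assumed : ∀ {Δ φ} → BQL (Δ ∪ ｛ φ ｝) φ
  assumed = hyp (inj₂ refl)

  ⇒-refl : ∀ {Δ φ} → BQL Δ (φ ⇒ φ)
  ⇒-refl = ⇒I assumed

  -- Any rule with one or two premises can be applied under an antecedent
  -- A; there is no modus ponens, so this goes through iTrans (and i∧I).
  under : ∀ {Δ A P Q} → (∀ {Δ′} → BQL Δ′ P → BQL Δ′ Q) →
          BQL Δ (A ⇒ P) → BQL Δ (A ⇒ Q)
  under rule d = iTrans d (⇒I (rule assumed))

  under₂ : ∀ {Δ A P Q R} → (∀ {Δ′} → BQL Δ′ P → BQL Δ′ Q → BQL Δ′ R) →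
           BQL Δ (A ⇒ P) → BQL Δ (A ⇒ Q) → BQL Δ (A ⇒ R)
  under₂ rule d e = iTrans (i∧I d e) (⇒I (rule (∧E₁ assumed) (∧E₂ assumed)))

  curry : ∀ {Δ φ B ψ} → BQL Δ (φ ∧' B ⇒ ψ) → BQL Δ (B ⇒ φ ⇒ ψ)
  curry d = ⇒I (iTrans (i∧I ⇒-refl (⇒I (hyp (inj₁ (inj₂ refl))))) (BQL-mono inj₁ d))

  ∧-distribʳ-∨ : ∀ {Δ φ ψ B} → BQL Δ ((φ ∨' ψ) ∧' B ⇒ (φ ∧' B) ∨' (ψ ∧' B))
  ∧-distribʳ-∨ = ⇒I (∨E (∧E₁ assumed)
                        (∨I₁ (∧I assumed (∧E₂ (hyp (inj₁ (inj₂ refl))))))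
                        (∨I₂ (∧I assumed (∧E₂ (hyp (inj₁ (inj₂ refl)))))))

  ∨E-under : ∀ {Δ φ ψ χ B} → BQL Δ (B ⇒ φ ∨' ψ) →
             BQL Δ (φ ∧' B ⇒ χ) → BQL Δ (ψ ∧' B ⇒ χ) → BQL Δ (B ⇒ χ)
  ∨E-under d e f = iTrans (i∧I d ⇒-refl) (iTrans ∧-distribʳ-∨ (i∨E e f))

  mutual
    subT-renT : ∀ {n m} (σ : Fin m → Term n) (ρ : Fin n → Fin m) →
                (∀ x → σ (ρ x) ≡ var x) → (t : Term n) → subT σ (renT ρ t) ≡ t
    subT-renT σ ρ h (var x)    = h x
    subT-renT σ ρ h (par i)    = refl
    subT-renT σ ρ h (app f ts) = cong (app f) (subTs-renTs σ ρ h ts)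

    subTs-renTs : ∀ {n m k} (σ : Fin m → Term n) (ρ : Fin n → Fin m) →
                  (∀ x → σ (ρ x) ≡ var x) → (ts : Vec (Term n) k) →
                  subTs σ (renTs ρ ts) ≡ ts
    subTs-renTs σ ρ h []       = refl
    subTs-renTs σ ρ h (t ∷ ts) = cong₂ _∷_ (subT-renT σ ρ h t) (subTs-renTs σ ρ h ts)

  lift-inverse : ∀ {n m} (σ : Fin m → Term n) (ρ : Fin n → Fin m) →
                 (∀ x → σ (ρ x) ≡ var x) → ∀ x → liftS σ (liftR ρ x) ≡ var x
  lift-inverse σ ρ h zero    = refl
  lift-inverse σ ρ h (suc x) = cong (renT suc) (h x)

  subF-renF : ∀ {n m} (σ : Fin m → Term n) (ρ : Fin n → Fin m) →
              (∀ x → σ (ρ x) ≡ var x) → (φ : Formula n) → subF σ (renF ρ φ) ≡ φ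
  subF-renF σ ρ h (atom R ts) = cong (atom R) (subTs-renTs σ ρ h ts)
  subF-renF σ ρ h ⊤'          = refl
  subF-renF σ ρ h ⊥'          = refl
  subF-renF σ ρ h (φ ∧' ψ)    = cong₂ _∧'_ (subF-renF σ ρ h φ) (subF-renF σ ρ h ψ)
  subF-renF σ ρ h (φ ∨' ψ)    = cong₂ _∨'_ (subF-renF σ ρ h φ) (subF-renF σ ρ h ψ)
  subF-renF σ ρ h (φ ⇒ ψ)     = cong₂ _⇒_ (subF-renF σ ρ h φ) (subF-renF σ ρ h ψ)
  subF-renF σ ρ h (∀' φ)      = cong ∀' (subF-renF (liftS σ) (liftR ρ) (lift-inverse σ ρ h) φ)
  subF-renF σ ρ h (∃' φ)      = cong ∃' (subF-renF (liftS σ) (liftR ρ) (lift-inverse σ ρ h) φ)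

  wk-[] : (φ : Sentence) (t : ClosedTerm) → wk φ [ t ] ≡ φ
  wk-[] φ t = subF-renF (single t) suc (λ ()) φ

  mutual
    occT-renT : ∀ {n m} i (ρ : Fin n → Fin m) (t : Term n) → occT i (renT ρ t) → occT i t
    occT-renT i ρ (var x) ()
    occT-renT i ρ (par j) o    = o
    occT-renT i ρ (app f ts) o = occTs-renTs i ρ ts o

    occTs-renTs : ∀ {n m k} i (ρ : Fin n → Fin m) (ts : Vec (Term n) k) →
                  occTs i (renTs ρ ts) → occTs i ts
    occTs-renTs i ρ (t ∷ ts) (inj₁ o) = inj₁ (occT-renT i ρ t o)
    occTs-renTs i ρ (t ∷ ts) (inj₂ o) = inj₂ (occTs-renTs i ρ ts o)

  occF-renF : ∀ {n m} i (ρ : Fin n → Fin m) (φ : Formula n) → occF i (renF ρ φ) → occF i φ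
  occF-renF i ρ (atom R ts) o = occTs-renTs i ρ ts o
  occF-renF i ρ (φ ∧' ψ) o    = ⊎.map (occF-renF i ρ φ) (occF-renF i ρ ψ) o
  occF-renF i ρ (φ ∨' ψ) o    = ⊎.map (occF-renF i ρ φ) (occF-renF i ρ ψ) o
  occF-renF i ρ (φ ⇒ ψ) o     = ⊎.map (occF-renF i ρ φ) (occF-renF i ρ ψ) o
  occF-renF i ρ (∀' φ) o      = occF-renF i (liftR ρ) φ o
  occF-renF i ρ (∃' φ) o      = occF-renF i (liftR ρ) φ o

  ¬occ-wk : ∀ {i} (φ : Sentence) → ¬ occF i φ → ¬ occF i (wk φ)
  ¬occ-wk φ n = n ∘ occF-renF _ suc φ

  mutual
    occT? : ∀ {n} i (t : Term n) → Dec (occT i t)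
    occT? i (var x)    = no λ ()
    occT? i (par j)    = i ℕ.≟ j
    occT? i (app f ts) = occTs? i ts

    occTs? : ∀ {n k} i (ts : Vec (Term n) k) → Dec (occTs i ts)
    occTs? i []       = no λ ()
    occTs? i (t ∷ ts) = occT? i t ⊎-dec occTs? i ts

  occF? : ∀ {n} i (φ : Formula n) → Dec (occF i φ)
  occF? i (atom R ts) = occTs? i ts
  occF? i ⊤'          = no λ ()
  occF? i ⊥'          = no λ ()
  occF? i (φ ∧' ψ)    = occF? i φ ⊎-dec occF? i ψ
  occF? i (φ ∨' ψ)    = occF? i φ ⊎-dec occF? i ψ
  occF? i (φ ⇒ ψ)     = occF? i φ ⊎-dec occF? i ψ
  occF? i (∀' φ)      = occF? i φ
  occF? i (∃' φ)      = occF? i φ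

  -- The ⊤-terminated conjunction of a list; unlike ⋀ it satisfies
  -- ⋀⊤ (χ ∷ Γ) = χ ∧ ⋀⊤ Γ definitionally, which makes discharge uniform.
  ⋀⊤ : List Sentence → Sentence
  ⋀⊤ []       = ⊤'
  ⋀⊤ (χ ∷ Γ) = χ ∧' ⋀⊤ Γ

  ⋀⇒⋀⊤ : ∀ {Δ} Γ → BQL Δ (⋀ Γ) → BQL Δ (⋀⊤ Γ)
  ⋀⇒⋀⊤ []          d = ⊤I
  ⋀⇒⋀⊤ (χ ∷ [])    d = ∧I d ⊤I
  ⋀⇒⋀⊤ (χ ∷ ψ ∷ Γ) d = ∧I (∧E₁ d) (⋀⇒⋀⊤ (ψ ∷ Γ) (∧E₂ d))

  ⋀⊤-elim : ∀ {Δ χ} Γ → χ ∈ Γ → BQL Δ (⋀⊤ Γ) → BQL Δ χ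
  ⋀⊤-elim (ψ ∷ Γ) (here refl) d = ∧E₁ d
  ⋀⊤-elim (ψ ∷ Γ) (there m)   d = ⋀⊤-elim Γ m (∧E₂ d)

  ⋀⊤-sub : ∀ {Δ} Γ Γ′ → (∀ {χ} → χ ∈ Γ′ → χ ∈ Γ) → BQL Δ (⋀⊤ Γ ⇒ ⋀⊤ Γ′)
  ⋀⊤-sub {Δ} Γ Γ′ sub = ⇒I (intro Γ′ sub)
    where
    intro : ∀ Γ″ → (∀ {χ} → χ ∈ Γ″ → χ ∈ Γ) → BQL (Δ ∪ ｛ ⋀⊤ Γ ｝) (⋀⊤ Γ″)
    intro []       sub = ⊤I
    intro (χ ∷ Γ″) sub = ∧I (⋀⊤-elim Γ (sub (here refl)) assumed) (intro Γ″ (sub ∘ there))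

  ⋀⊤-avoids : ∀ {i} Γ → Avoids i (ListSet Γ) → ¬ occF i (⋀⊤ Γ)
  ⋀⊤-avoids (χ ∷ Γ) av (inj₁ o) = av (here refl) o
  ⋀⊤-avoids (χ ∷ Γ) av (inj₂ o) = ⋀⊤-avoids Γ (λ m → av (there m)) o

  avoids? : ∀ i (χ : Sentence) → Dec (¬ occF i χ)
  avoids? i χ = ¬? (occF? i χ)

  avoiding : ℕ → List Sentence → List Sentence
  avoiding i = filter (avoids? i)

  avoiding-⊆ : ∀ i Γ {χ} → χ ∈ avoiding i Γ → χ ∈ Γ
  avoiding-⊆ i Γ m = proj₁ (∈-filter⁻ (avoids? i) {xs = Γ} m)

  avoiding-avoids : ∀ i Γ → ¬ occF i (⋀⊤ (avoiding i Γ))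
  avoiding-avoids i Γ =
    ⋀⊤-avoids (avoiding i Γ) (λ m → proj₂ (∈-filter⁻ (avoids? i) {xs = Γ} m))

  ∀I-under : ∀ {Δ Δ′ B} {φ : Formula 1} i → Δ′ ⊆ Δ → Avoids i Δ′ →
             ¬ occF i B → ¬ occF i φ →
             BQL Δ′ (B ⇒ φ [ par i ]) → BQL Δ (B ⇒ ∀' φ)
  ∀I-under {Δ′ = Δ′} {B} {φ} i sub av nB nφ d =
    i∀I (∀I i Δ′ sub av [ ¬occ-wk B nB , nφ ]
          (subst (λ X → BQL Δ′ (X ⇒ φ [ par i ])) (sym (wk-[] B (par i))) d))

  ∃-∧-pull : ∀ {Δ B} {φ : Formula 1} i → ¬ occF i φ → ¬ occF i B →
             BQL Δ (∃' φ ∧' B ⇒ ∃' (φ ∧' wk B))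
  ∃-∧-pull {B = B} {φ} i nφ nB =
    ⇒I (∃E i ｛ ∃' φ ∧' B ｝ (∧E₁ assumed) inj₂ fresh nφ [ nφ , ¬occ-wk B nB ]
          (∃I (par i) witness))
    where
    fresh : Avoids i ｛ ∃' φ ∧' B ｝
    fresh refl = [ nφ , nB ]
    witness : BQL (｛ ∃' φ ∧' B ｝ ∪ ｛ φ [ par i ] ｝) (φ [ par i ] ∧' wk B [ par i ])
    witness rewrite wk-[] B (par i) = ∧I assumed (∧E₂ (hyp (inj₁ refl)))

  ∃E-under : ∀ {Δ Δ′ B ψ} {φ : Formula 1} i → Δ′ ⊆ Δ → Avoids i Δ′ →
             ¬ occF i φ → ¬ occF i B → ¬ occF i ψ →
             BQL Δ′ (φ [ par i ] ∧' B ⇒ ψ) → BQL Δ (∃' φ ∧' B ⇒ ψ)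
  ∃E-under {Δ′ = Δ′} {B} {ψ} {φ} i sub av nφ nB nψ d =
    iTrans (∃-∧-pull i nφ nB)
           (i∃E (∀I i Δ′ sub av [ [ nφ , ¬occ-wk B nB ] , ¬occ-wk ψ nψ ] d′))
    where
    d′ : BQL Δ′ (φ [ par i ] ∧' wk B [ par i ] ⇒ wk ψ [ par i ])
    d′ rewrite wk-[] B (par i) | wk-[] ψ (par i) = d

  -- Bookkeeping on assumption sets: discharging χ moves it into the
  -- antecedent list, and below an eigenvariable rule with assumption
  -- bounds S′, U′ the set Δ may be cut down to Δ ∩ (S′ ∪ U′), which a_i
  -- avoids, while Γ is cut down to the members avoiding a_i.
  discharge : ∀ {S Δ : Pred Sentence 0ℓ} {χ} Γ →
              S ⊆ Δ ∪ ListSet Γ → (S ∪ ｛ χ ｝) ⊆ Δ ∪ ListSet (χ ∷ Γ)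
  discharge Γ h (inj₁ s)    = ⊎.map₂ there (h s)
  discharge Γ h (inj₂ refl) = inj₂ (here refl)

  restrict-safe : ∀ {S Δ S′ U′ : Pred Sentence 0ℓ} i Γ →
                  S ⊆ Δ ∪ ListSet Γ → S′ ⊆ S → Avoids i S′ →
                  S′ ⊆ (Δ ∩ (S′ ∪ U′)) ∪ ListSet (avoiding i Γ)
  restrict-safe i Γ h s av {χ} sχ with h (s sχ)
  ... | inj₁ d = inj₁ (d , inj₁ sχ)
  ... | inj₂ m = inj₂ (∈-filter⁺ (avoids? i) m (av sχ))

  restrict-avoids : ∀ {i} {Δ S′ U′ : Pred Sentence 0ℓ} →
                    Avoids i S′ → Avoids i U′ → Avoids i (Δ ∩ (S′ ∪ U′))
  restrict-avoids aS aU (_ , inj₁ s) = aS s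
  restrict-avoids aS aU (_ , inj₂ u) = aU u

  deduction : ∀ {Σ S U : Pred Sentence 0ℓ} {φ} (Δ : Pred Sentence 0ℓ) Γ →
              S ⊆ Δ ∪ ListSet Γ → U ⊆ Δ → BQLΣ Σ S U φ → BQL Δ (⋀⊤ Γ ⇒ φ)
  deduction Δ Γ h u (hyp s) with h s
  ... | inj₁ d = ⇒I (hyp (inj₁ d))
  ... | inj₂ m = ⇒I (⋀⊤-elim Γ m assumed)
  deduction Δ Γ h u ⊤I           = ⇒I ⊤I
  deduction Δ Γ h u (⊥E d)       = under ⊥E (deduction Δ Γ h u d)
  deduction Δ Γ h u (∧I d e)     = i∧I (deduction Δ Γ h u d) (deduction Δ Γ h u e)
  deduction Δ Γ h u (∧E₁ d)      = under ∧E₁ (deduction Δ Γ h u d)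
  deduction Δ Γ h u (∧E₂ d)      = under ∧E₂ (deduction Δ Γ h u d)
  deduction Δ Γ h u (∨I₁ d)      = under ∨I₁ (deduction Δ Γ h u d)
  deduction Δ Γ h u (∨I₂ d)      = under ∨I₂ (deduction Δ Γ h u d)
  deduction Δ Γ h u (∨E d e f)   =
    ∨E-under (deduction Δ Γ h u d) (deduction Δ (_ ∷ Γ) (discharge Γ h) u e)
                                   (deduction Δ (_ ∷ Γ) (discharge Γ h) u f)
  deduction Δ Γ h u (⇒I d)       = curry (deduction Δ (_ ∷ Γ) (discharge Γ h) u d)
  deduction Δ Γ h u (iTrans d e) = under₂ iTrans (deduction Δ Γ h u d) (deduction Δ Γ h u e)
  deduction Δ Γ h u (i∧I d e)    = under₂ i∧I (deduction Δ Γ h u d) (deduction Δ Γ h u e)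
  deduction Δ Γ h u (i∨E d e)    = under₂ i∨E (deduction Δ Γ h u d) (deduction Δ Γ h u e)
  deduction Δ Γ h u (i∀I d)      = under i∀I (deduction Δ Γ h u d)
  deduction Δ Γ h u (i∃E d)      = under i∃E (deduction Δ Γ h u d)
  deduction Δ Γ h u (∀E t d)     = under (∀E t) (deduction Δ Γ h u d)
  deduction Δ Γ h u (CD d)       = under CD (deduction Δ Γ h u d)
  deduction Δ Γ h u (∃I t d)     = under (∃I t) (deduction Δ Γ h u d)
  deduction Δ Γ h u (mp d e)     = iTrans (deduction Δ Γ h u d) (BQL-mono (u ∘ proj₂) e)
  deduction Δ Γ h u (∀I i S′ U′ s u′ aS aU nφ d) =
    iTrans (⋀⊤-sub Γ Γ″ (avoiding-⊆ i Γ))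
           (∀I-under i proj₁ fresh (avoiding-avoids i Γ) nφ
              (deduction Δ″ Γ″ safe unsafe d))
    where
    Δ″ : Pred Sentence 0ℓ
    Δ″ = Δ ∩ (S′ ∪ U′)
    Γ″ : List Sentence
    Γ″ = avoiding i Γ
    fresh : Avoids i Δ″
    fresh = restrict-avoids {Δ = Δ} {S′} {U′} aS aU
    safe : S′ ⊆ Δ″ ∪ ListSet Γ″
    safe = restrict-safe {U′ = U′} i Γ h s aS
    unsafe : U′ ⊆ Δ″
    unsafe x = u (u′ x) , inj₂ x
  deduction Δ Γ h u (∃E i S′ U′ d s u′ aS aU _ nφ nψ e) =
    iTrans (i∧I (deduction Δ Γ h u d) (⋀⊤-sub Γ Γ″ (avoiding-⊆ i Γ)))
           (∃E-under i proj₁ fresh nφ (avoiding-avoids i Γ) nψ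
              (deduction Δ″ (_ ∷ Γ″) (discharge Γ″ safe) unsafe e))
    where
    Δ″ : Pred Sentence 0ℓ
    Δ″ = Δ ∩ (S′ ∪ U′)
    Γ″ : List Sentence
    Γ″ = avoiding i Γ
    fresh : Avoids i Δ″
    fresh = restrict-avoids {Δ = Δ} {S′} {U′} aS aU
    safe : S′ ⊆ Δ″ ∪ ListSet Γ″
    safe = restrict-safe {U′ = U′} i Γ h s aS
    unsafe : U′ ⊆ Δ″
    unsafe x = u (u′ x) , inj₂ x

mainTheorem8 : (L : Signature) → let open Syntax L in
    (Σ Σ' : Pred Sentence 0ℓ) (Γ : List Sentence) (φ : Sentence) →
    BQLΣ Σ (Σ' ∪ ListSet Γ) Σ' φ →
    BQL Σ' (⋀ Γ ⇒ φ)
mainTheorem8 L Σ Σ' Γ φ d =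
  iTrans (⇒I (⋀⇒⋀⊤ Γ assumed)) (deduction Σ' Γ id id d)
  where
  open Syntax L
  open Deduction L
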